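{- Let $k$ be a positive integer and $p$ an integer with $0\le p\le k-1$. For all integers $n\ge 1$, (1) $a_k(n)=k\,b_k(n)$, and (2) $a_{k,p}(n)=(k-p)\,b_k(n-p)+p\,b_k(n+k-p)$.
   Context: A partition of a positive integer $n$ is a weakly decreasing finite sequence of positive integers (parts) summing to $n$. For a positive integer $n$: $a_k(n)$ is the sum, over all partitions $\lambda$ of $n$, of the sum of the distinct part values of $\lambda$ that are divisible by $k$ (each distinct value counted once per partition); $a_{k,p}(n)$ is the sum, over all partitions $\lambda$ of $n$, of the sum of the distinct part values of $\lambda$ congruent to $p\pmod k$ (each counted once per partition); $b_k(n)$ is the sum, over all partitions $\lambda$ of $n$, of the sum of the distinct part values of $\lambda$ that appear at least $k$ times in $\lambda$. Convention: $b_k(m)=0$ for integers $m\le 0$. -}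

module Defs where

open import Data.Nat using (ℕ; zero; suc; _+_; _*_; _∸_; _≤_; _<_; _≤ᵇ_; _≡ᵇ_; _%_; NonZero)
open import Data.Nat.Properties using (_≟_; _≤?_)
open import Data.Nat.ListAction using (sum)
open import Data.List using (List; []; _∷_; map; concatMap; length; filter; upTo; applyUpTo)
open import Data.Integer using (ℤ; +_; -[1+_])
open import Data.Bool using (Bool; true; false; if_then_else_)
open import Relation.Nullary using (does)

-- partitionsMax m n : all partitions of n (weakly decreasing lists of
-- positive integers summing to n) whose largest part is at most m.
-- Fuel-free structural recursion on n via an auxiliary fuel argument f ≥ n.
partsAux : ℕ → ℕ → ℕ → List (List ℕ)
partsAux _        _ zero    = [] ∷ []
partsAux zero     _ (suc _) = []
partsAux (suc f)  m (suc n) =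
  concatMap (λ j → let v = suc j in
                   map (v ∷_) (partsAux f v (suc n ∸ v)))
            (filter (λ j → suc j ≤? m) (upTo (suc n)))

partitions : ℕ → List (List ℕ)
partitions n = partsAux n n n

mult : ℕ → List ℕ → ℕ
mult v λ' = length (filter (λ x → x ≟ v) λ')

-- sum of the distinct part values of λ' satisfying predicate P
-- (each distinct value counted once); part values of a partition of n lie in 1..n
distinctSum : (ℕ → Bool) → ℕ → List ℕ → ℕ
distinctSum P n λ' =
  sum (map (λ j → let v = suc j in
                  if (1 ≤ᵇ mult v λ') Data.Bool.∧ P v then v else 0)
           (upTo n))

a : ℕ → ℕ → ℕ
a k n = sum (map (distinctSum (λ v → divisible k v) n) (partitions n))
  where
  divisible : ℕ → ℕ → Bool
  divisible zero    v = v ≡ᵇ 0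
  divisible (suc k) v = (v % suc k) ≡ᵇ 0

aMod : ℕ → ℕ → ℕ → ℕ
aMod k p n = sum (map (distinctSum (λ v → cong k v) n) (partitions n))
  where
  cong : ℕ → ℕ → Bool
  cong zero    v = v ≡ᵇ p
  cong (suc k) v = (v % suc k) ≡ᵇ (p % suc k)

b : ℕ → ℕ → ℕ
b k n = sum (map (λ λ' → distinctSum (λ v → k ≤ᵇ mult v λ') n λ') (partitions n))

bℤ : ℕ → ℤ → ℕ
bℤ k (+ n)    = b k n
bℤ k -[1+ _ ] = 0

-- Removing c copies of a part v is a bijection from the partitions of n in which v occurs at least
-- c times onto the partitions of n - cv, so a_{k,p} and b_k are convolutions of the partition
-- function P with the weights  aWeight d = d [d ≡ p mod k]  and  bWeight d = d/k [k | d].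
-- For d = p + qk one has d = (k - p) q + p (q + 1), i.e.
--   aWeight d = (k - p) bWeight (d - p) + p bWeight (d + k - p)
-- for every d, and convolving this identity with P gives (2); (1) is the case p = 0.
module Submission where

open import Defs
open import Data.Nat using (ℕ; _+_; _*_; _∸_; _≤_; _<_)
open import Data.Integer using (ℤ; +_; _-_)
open import Data.Product using (_×_)
open import Relation.Binary.PropositionalEquality using (_≡_)

open import Data.Bool using (Bool; true; false; if_then_else_; _∧_)
open import Data.Integer using (-_)
open import Data.Integer.Properties using (m-n≡m⊖n; ⊖-≥; ⊖-<)
open import Data.List using (List; []; _∷_; _++_; map; concatMap; filter; length; upTo; applyUpTo)
open import Data.List.Properties using (map-++; map-cong; map-∘; map-upTo; filter-accept; filter-reject)
open import Data.Nat using (zero; suc; _≤ᵇ_; _≡ᵇ_; _%_; _/_; NonZero; z≤n; s≤s; z<s)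
open import Data.Nat.DivMod
  using (m≡m%n+[m/n]*n; m*n%n≡0; m*n/n≡m; m<n⇒m/n≡0; m<n⇒m%n≡m; m%n%n≡m%n; [m+kn]%n≡m%n; [m+n]%n≡m%n; %-distribˡ-+)
open import Data.Nat.ListAction using (sum)
open import Data.Nat.ListAction.Properties using (sum-++)
open import Data.Nat.Properties
open import Data.Nat.Solver using (module +-*-Solver)
open import Data.Product using (_,_)
open import Data.Sum using (inj₁; inj₂)
open import Function using (_∘_; const)
open import Relation.Binary.PropositionalEquality using (refl; sym; trans; cong; cong₂; subst; _≢_; module ≡-Reasoning)
open import Relation.Nullary using (does; yes; no; ¬_)
open import Relation.Nullary.Decidable using (dec-true; dec-false)
open import Relation.Unary using (Pred; Decidable)

open import Algebra.Properties.CommutativeSemigroup +-commutativeSemigroup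
  using () renaming (interchange to +-interchange)

open +-*-Solver
open ≡-Reasoning

∑< : ℕ → (ℕ → ℕ) → ℕ
∑< n g = sum (applyUpTo g n)

syntax ∑< n (λ j → e) = ∑[ j < n ] e

∑<-cong : ∀ n {g h : ℕ → ℕ} → (∀ j → j < n → g j ≡ h j) → ∑< n g ≡ ∑< n h
∑<-cong zero    eq = refl
∑<-cong (suc n) eq = cong₂ _+_ (eq 0 z<s) (∑<-cong n (λ j j<n → eq (suc j) (s≤s j<n)))

∑<-zero : ∀ n {g : ℕ → ℕ} → (∀ j → j < n → g j ≡ 0) → ∑< n g ≡ 0
∑<-zero zero    eq = refl
∑<-zero (suc n) eq = cong₂ _+_ (eq 0 z<s) (∑<-zero n (λ j j<n → eq (suc j) (s≤s j<n)))

∑<-suc : ∀ n (g : ℕ → ℕ) → ∑< (suc n) g ≡ ∑< n g + g n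
∑<-suc zero    g = +-comm (g 0) 0
∑<-suc (suc n) g = trans (cong (_+_ (g 0)) (∑<-suc n (g ∘ suc))) (sym (+-assoc (g 0) _ _))

∑<-split : ∀ m n (g : ℕ → ℕ) → ∑< (m + n) g ≡ ∑< m g + ∑[ j < n ] g (m + j)
∑<-split zero    n g = refl
∑<-split (suc m) n g = trans (cong (_+_ (g 0)) (∑<-split m n (g ∘ suc))) (sym (+-assoc (g 0) _ _))

∑<-pad : ∀ {m n} (g : ℕ → ℕ) → m ≤ n → (∀ j → m ≤ j → g j ≡ 0) → ∑< n g ≡ ∑< m g
∑<-pad {m} {n} g m≤n vanish = begin
  ∑< n g                         ≡⟨ cong (λ l → ∑< l g) (sym (m+[n∸m]≡n m≤n)) ⟩
  ∑< (m + (n ∸ m)) g             ≡⟨ ∑<-split m (n ∸ m) g ⟩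
  ∑< m g + ∑[ j < n ∸ m ] g (m + j) ≡⟨ cong (_+_ (∑< m g)) (∑<-zero (n ∸ m) (λ j _ → vanish (m + j) (m≤m+n m j))) ⟩
  ∑< m g + 0                     ≡⟨ +-identityʳ _ ⟩
  ∑< m g                         ∎

∑<-distrib-+ : ∀ n (g h : ℕ → ℕ) → ∑[ j < n ] (g j + h j) ≡ ∑< n g + ∑< n h
∑<-distrib-+ zero    g h = refl
∑<-distrib-+ (suc n) g h = begin
  g 0 + h 0 + ∑[ j < n ] (g (suc j) + h (suc j))
    ≡⟨ cong (_+_ (g 0 + h 0)) (∑<-distrib-+ n (g ∘ suc) (h ∘ suc)) ⟩
  g 0 + h 0 + (∑< n (g ∘ suc) + ∑< n (h ∘ suc))
    ≡⟨ +-interchange (g 0) (h 0) _ _ ⟩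
  g 0 + ∑< n (g ∘ suc) + (h 0 + ∑< n (h ∘ suc)) ∎

*-distribˡ-∑< : ∀ n c (g : ℕ → ℕ) → c * ∑< n g ≡ ∑[ j < n ] (c * g j)
*-distribˡ-∑< zero    c g = *-zeroʳ c
*-distribˡ-∑< (suc n) c g = trans (*-distribˡ-+ c (g 0) _) (cong (_+_ (c * g 0)) (*-distribˡ-∑< n c (g ∘ suc)))

∑<-reverse : ∀ n (g : ℕ → ℕ) → ∑< n g ≡ ∑[ j < n ] g (n ∸ suc j)
∑<-reverse zero    g = refl
∑<-reverse (suc n) g = begin
  g 0 + ∑< n (g ∘ suc)                ≡⟨ cong (_+_ (g 0)) (∑<-reverse n (g ∘ suc)) ⟩
  g 0 + ∑[ j < n ] g (suc (n ∸ suc j)) ≡⟨ cong (_+_ (g 0)) (∑<-cong n (λ j j<n → cong g (sym (+-∸-assoc 1 j<n)))) ⟩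
  g 0 + ∑[ j < n ] g (n ∸ j)           ≡⟨ +-comm (g 0) _ ⟩
  ∑[ j < n ] g (n ∸ j) + g 0           ≡⟨ cong (λ i → ∑[ j < n ] g (n ∸ j) + g i) (sym (n∸n≡0 n)) ⟩
  ∑[ j < n ] g (n ∸ j) + g (n ∸ n)     ≡⟨ sym (∑<-suc n (λ j → g (n ∸ j))) ⟩
  ∑[ j < suc n ] g (n ∸ j)             ∎

sum-map-cong : ∀ {A : Set} {F G : A → ℕ} → (∀ x → F x ≡ G x) → ∀ xs → sum (map F xs) ≡ sum (map G xs)
sum-map-cong F≗G xs = cong sum (map-cong F≗G xs)

sum-map-++ : ∀ {A : Set} (F : A → ℕ) xs ys → sum (map F (xs ++ ys)) ≡ sum (map F xs) + sum (map F ys)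
sum-map-++ F xs ys = trans (cong sum (map-++ F xs ys)) (sum-++ (map F xs) (map F ys))

sum-map-concatMap : ∀ {A B : Set} (F : B → ℕ) (g : A → List B) xs →
  sum (map F (concatMap g xs)) ≡ sum (map (λ x → sum (map F (g x))) xs)
sum-map-concatMap F g []       = refl
sum-map-concatMap F g (x ∷ xs) =
  trans (sum-map-++ F (g x) (concatMap g xs)) (cong (_+_ (sum (map F (g x)))) (sum-map-concatMap F g xs))

sum-map-filter : ∀ {A : Set} {ℓ} {P : Pred A ℓ} (P? : Decidable P) (F : A → ℕ) xs →
  sum (map F (filter P? xs)) ≡ sum (map (λ x → if does (P? x) then F x else 0) xs)
sum-map-filter P? F []       = refl
sum-map-filter P? F (x ∷ xs) with does (P? x)
... | true  = cong (_+_ (F x)) (sum-map-filter P? F xs)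
... | false = sum-map-filter P? F xs

*-distribˡ-sum-map : ∀ {A : Set} c (F : A → ℕ) xs → c * sum (map F xs) ≡ sum (map (λ x → c * F x) xs)
*-distribˡ-sum-map c F []       = *-zeroʳ c
*-distribˡ-sum-map c F (x ∷ xs) = trans (*-distribˡ-+ c (F x) _) (cong (_+_ (c * F x)) (*-distribˡ-sum-map c F xs))

sum-map-∑<-comm : ∀ {A : Set} n (g : A → ℕ → ℕ) xs →
  sum (map (λ x → ∑< n (g x)) xs) ≡ ∑[ j < n ] sum (map (λ x → g x j) xs)
sum-map-∑<-comm n g []       = sym (∑<-zero n (λ _ _ → refl))
sum-map-∑<-comm n g (x ∷ xs) = trans (cong (_+_ (∑< n (g x))) (sum-map-∑<-comm n g xs))
                                     (sym (∑<-distrib-+ n (g x) (λ j → sum (map (λ y → g y j) xs))))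

if-≤ᵇ-yes : ∀ {m n} {A : Set} {x y : A} → m ≤ n → (if m ≤ᵇ n then x else y) ≡ x
if-≤ᵇ-yes {m} {n} m≤n = cong (if_then _ else _) (dec-true (m ≤? n) m≤n)

if-≤ᵇ-no : ∀ {m n} {A : Set} {x y : A} → ¬ m ≤ n → (if m ≤ᵇ n then x else y) ≡ y
if-≤ᵇ-no {m} {n} m≰n = cong (if_then _ else _) (dec-false (m ≤? n) m≰n)

if-∧-indicator : ∀ b c w → (if b ∧ c then w else 0) ≡ (if c then w else 0) * (if b then 1 else 0)
if-∧-indicator true  c w = sym (*-identityʳ _)
if-∧-indicator false c w = sym (*-zeroʳ (if c then w else 0))

if-indicator : ∀ b w → (if b then w else 0) ≡ w * (if b then 1 else 0)
if-indicator true  w = sym (*-identityʳ w)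
if-indicator false w = sym (*-zeroʳ w)

-- coefficientwise, multiplication of the generating function of g by q^d
delay : ℕ → (ℕ → ℕ) → ℕ → ℕ
delay d g n = if d ≤ᵇ n then g (n ∸ d) else 0

delay-cong : ∀ d {g h : ℕ → ℕ} n → g (n ∸ d) ≡ h (n ∸ d) → delay d g n ≡ delay d h n
delay-cong d n eq = cong (if d ≤ᵇ n then_else 0) eq

delay-≡0 : ∀ d (g : ℕ → ℕ) n → g (n ∸ d) ≡ 0 → delay d g n ≡ 0
delay-≡0 d g n eq with d ≤ᵇ n
... | true  = eq
... | false = refl

delay-+ : ∀ a b (g : ℕ → ℕ) n → delay a (delay b g) n ≡ delay (a + b) g n
delay-+ a b g n with a ≤? n
... | no a≰n = trans (if-≤ᵇ-no a≰n) (sym (if-≤ᵇ-no (λ a+b≤n → a≰n (≤-trans (m≤m+n a b) a+b≤n))))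
... | yes a≤n with b ≤? n ∸ a
...   | yes b≤n∸a = begin
  delay a (delay b g) n ≡⟨ trans (if-≤ᵇ-yes a≤n) (if-≤ᵇ-yes b≤n∸a) ⟩
  g (n ∸ a ∸ b)         ≡⟨ cong g (∸-+-assoc n a b) ⟩
  g (n ∸ (a + b))       ≡⟨ sym (if-≤ᵇ-yes (subst (_≤ n) (+-comm b a) (m≤o∸n⇒m+n≤o b a≤n b≤n∸a))) ⟩
  delay (a + b) g n     ∎
...   | no b≰n∸a = trans (trans (if-≤ᵇ-yes a≤n) (if-≤ᵇ-no b≰n∸a))
                         (sym (if-≤ᵇ-no (λ a+b≤n → b≰n∸a (m+n≤o⇒m≤o∸n b (subst (_≤ n) (+-comm a b) a+b≤n)))))

delay-comm : ∀ a b (g : ℕ → ℕ) n → delay a (delay b g) n ≡ delay b (delay a g) n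
delay-comm a b g n = begin
  delay a (delay b g) n ≡⟨ delay-+ a b g n ⟩
  delay (a + b) g n     ≡⟨ cong (λ d → delay d g n) (+-comm a b) ⟩
  delay (b + a) g n     ≡⟨ sym (delay-+ b a g n) ⟩
  delay b (delay a g) n ∎

delay-distrib-+ : ∀ d (g h : ℕ → ℕ) n → delay d g n + delay d h n ≡ delay d (λ x → g x + h x) n
delay-distrib-+ d g h n with d ≤ᵇ n
... | true  = refl
... | false = refl

partsAuxSum : ℕ → ℕ → ℕ → (List ℕ → ℕ) → ℕ
partsAuxSum fuel m n F = sum (map F (partsAux fuel m n))

partSum≤ : ℕ → ℕ → (List ℕ → ℕ) → ℕ
partSum≤ m n = partsAuxSum n m n

partitionCount≤ : ℕ → ℕ → ℕ
partitionCount≤ m n = partSum≤ m n (const 1)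

partitionCount : ℕ → ℕ
partitionCount n = partitionCount≤ n n

partsAuxSum-suc : ∀ f m n F → partsAuxSum (suc f) m (suc n) F ≡
  ∑[ j < suc n ] (if suc j ≤ᵇ m then partsAuxSum f (suc j) (n ∸ j) (F ∘ (suc j ∷_)) else 0)
partsAuxSum-suc f m n F = begin
  partsAuxSum (suc f) m (suc n) F
    ≡⟨ sum-map-concatMap F _ (filter (λ j → suc j ≤? m) (upTo (suc n))) ⟩
  sum (map (λ j → sum (map F (map (suc j ∷_) (partsAux f (suc j) (n ∸ j))))) (filter (λ j → suc j ≤? m) (upTo (suc n))))
    ≡⟨ sum-map-filter (λ j → suc j ≤? m) _ (upTo (suc n)) ⟩
  sum (map (λ j → if suc j ≤ᵇ m then sum (map F (map (suc j ∷_) (partsAux f (suc j) (n ∸ j)))) else 0) (upTo (suc n)))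
    ≡⟨ sum-map-cong (λ j → cong (if suc j ≤ᵇ m then_else 0) (cong sum (sym (map-∘ (partsAux f (suc j) (n ∸ j))))))
                    (upTo (suc n)) ⟩
  sum (map (λ j → if suc j ≤ᵇ m then partsAuxSum f (suc j) (n ∸ j) (F ∘ (suc j ∷_)) else 0) (upTo (suc n)))
    ≡⟨ cong sum (map-upTo _ (suc n)) ⟩
  ∑[ j < suc n ] (if suc j ≤ᵇ m then partsAuxSum f (suc j) (n ∸ j) (F ∘ (suc j ∷_)) else 0) ∎

partsAuxSum-fuel : ∀ f f′ m n F → n ≤ f → n ≤ f′ → partsAuxSum f m n F ≡ partsAuxSum f′ m n F
partsAuxSum-fuel f       f′       m zero    F _       _        = refl
partsAuxSum-fuel (suc f) (suc f′) m (suc n) F (s≤s n≤f) (s≤s n≤f′) = begin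
  partsAuxSum (suc f) m (suc n) F  ≡⟨ partsAuxSum-suc f m n F ⟩
  ∑[ j < suc n ] (if suc j ≤ᵇ m then partsAuxSum f (suc j) (n ∸ j) (F ∘ (suc j ∷_)) else 0)
    ≡⟨ ∑<-cong (suc n) (λ j _ → cong (if suc j ≤ᵇ m then_else 0)
         (partsAuxSum-fuel f f′ (suc j) (n ∸ j) (F ∘ (suc j ∷_))
                           (≤-trans (m∸n≤m n j) n≤f) (≤-trans (m∸n≤m n j) n≤f′))) ⟩
  ∑[ j < suc n ] (if suc j ≤ᵇ m then partsAuxSum f′ (suc j) (n ∸ j) (F ∘ (suc j ∷_)) else 0)
    ≡⟨ sym (partsAuxSum-suc f′ m n F) ⟩
  partsAuxSum (suc f′) m (suc n) F ∎

∑<-guard-suc : ∀ N (X : ℕ → ℕ) m →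
  ∑[ j < N ] (if suc j ≤ᵇ suc m then X j else 0) ≡
  ∑[ j < N ] (if suc j ≤ᵇ m then X j else 0) + (if suc m ≤ᵇ N then X m else 0)
∑<-guard-suc zero    X m       = refl
∑<-guard-suc (suc N) X zero    = +-comm (X 0) (∑[ j < N ] 0)
∑<-guard-suc (suc N) X (suc m) = trans (cong (_+_ (X 0)) (∑<-guard-suc N (X ∘ suc) m)) (sym (+-assoc (X 0) _ _))

partSum≤-suc : ∀ m n F → partSum≤ (suc m) n F ≡
  partSum≤ m n F + delay (suc m) (λ r → partSum≤ (suc m) r (F ∘ (suc m ∷_))) n
partSum≤-suc m zero    F = sym (+-identityʳ _)
partSum≤-suc m (suc n) F = begin
  partsAuxSum (suc n) (suc m) (suc n) F
    ≡⟨ partsAuxSum-suc n (suc m) n F ⟩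
  ∑[ j < suc n ] (if suc j ≤ᵇ suc m then parts j else 0)
    ≡⟨ ∑<-guard-suc (suc n) parts m ⟩
  ∑[ j < suc n ] (if suc j ≤ᵇ m then parts j else 0) + (if suc m ≤ᵇ suc n then parts m else 0)
    ≡⟨ cong₂ _+_ (sym (partsAuxSum-suc n m n F))
                 (cong (if suc m ≤ᵇ suc n then_else 0) (partsAuxSum-fuel n (n ∸ m) (suc m) (n ∸ m) _ (m∸n≤m n m) ≤-refl)) ⟩
  partSum≤ m (suc n) F + delay (suc m) (λ r → partSum≤ (suc m) r (F ∘ (suc m ∷_))) (suc n) ∎
  where
  parts : ℕ → ℕ
  parts j = partsAuxSum n (suc j) (n ∸ j) (F ∘ (suc j ∷_))

partSum≤-large : ∀ m n F → n ≤ m → partSum≤ m n F ≡ partSum≤ n n F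
partSum≤-large m zero    F _   = refl
partSum≤-large m (suc n) F n<m = begin
  partsAuxSum (suc n) m (suc n) F ≡⟨ partsAuxSum-suc n m n F ⟩
  ∑[ j < suc n ] (if suc j ≤ᵇ m then parts j else 0)
    ≡⟨ ∑<-cong (suc n) (λ j j≤n → trans (if-≤ᵇ-yes {x = parts j} {y = 0} (≤-trans j≤n n<m))
                                         (sym (if-≤ᵇ-yes {y = 0} j≤n))) ⟩
  ∑[ j < suc n ] (if suc j ≤ᵇ suc n then parts j else 0) ≡⟨ sym (partsAuxSum-suc n (suc n) n F) ⟩
  partsAuxSum (suc n) (suc n) (suc n) F ∎
  where
  parts : ℕ → ℕ
  parts j = partsAuxSum n (suc j) (n ∸ j) (F ∘ (suc j ∷_))

multAtLeast : ℕ → ℕ → List ℕ → ℕ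
multAtLeast c v ps = if c ≤ᵇ mult v ps then 1 else 0

mult-here : ∀ v ps → mult v (v ∷ ps) ≡ suc (mult v ps)
mult-here v ps = cong length (filter-accept (_≟ v) refl)

mult-there : ∀ {v w} ps → w ≢ v → mult v (w ∷ ps) ≡ mult v ps
mult-there {v} ps w≢v = cong length (filter-reject (_≟ v) w≢v)

multAtLeast-here : ∀ c v ps → multAtLeast (suc c) v (v ∷ ps) ≡ multAtLeast c v ps
multAtLeast-here c v ps = trans (cong (λ x → if suc c ≤ᵇ x then 1 else 0) (mult-here v ps)) (suc≤ᵇsuc c)
  where
  suc≤ᵇsuc : ∀ c → (if suc c ≤ᵇ suc (mult v ps) then 1 else 0) ≡ multAtLeast c v ps
  suc≤ᵇsuc zero    = refl
  suc≤ᵇsuc (suc c) = refl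

multAtLeast-there : ∀ c {v w} ps → w ≢ v → multAtLeast c v (w ∷ ps) ≡ multAtLeast c v ps
multAtLeast-there c ps w≢v = cong (λ x → if c ≤ᵇ x then 1 else 0) (mult-there ps w≢v)

partSum≤-multAtLeast-absent : ∀ {m v} c n → m < v → partSum≤ m n (multAtLeast (suc c) v) ≡ 0
partSum≤-multAtLeast-absent {m} {v} c n m<v = absent m n n ≤-refl m<v
  where
  -- the bound N makes the recursion structural
  absent : ∀ m N n → n ≤ N → m < v → partSum≤ m n (multAtLeast (suc c) v) ≡ 0
  absent m       N       zero    _         _   = refl
  absent zero    (suc N) (suc n) _         _   = trans (partsAuxSum-suc n 0 n _) (∑<-zero (suc n) (λ _ _ → refl))
  absent (suc m) (suc N) (suc n) (s≤s n≤N) m<v = begin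
    partSum≤ (suc m) (suc n) A
      ≡⟨ partSum≤-suc m (suc n) A ⟩
    partSum≤ m (suc n) A + delay (suc m) (λ r → partSum≤ (suc m) r (A ∘ (suc m ∷_))) (suc n)
      ≡⟨ cong₂ _+_ (absent m (suc N) (suc n) (s≤s n≤N) (<-trans (n<1+n m) m<v))
                   (delay-≡0 (suc m) (λ r → partSum≤ (suc m) r (A ∘ (suc m ∷_))) (suc n)
                     (trans (sum-map-cong (λ ps → multAtLeast-there (suc c) ps (<⇒≢ m<v)) (partsAux (n ∸ m) (suc m) (n ∸ m)))
                     (absent (suc m) N (n ∸ m) (≤-trans (m∸n≤m n m) n≤N) m<v))) ⟩
    0 ∎
    where
    A : List ℕ → ℕ
    A = multAtLeast (suc c) v

partSum≤-multAtLeast : ∀ {m v} c n → suc v ≤ m →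
  partSum≤ m n (multAtLeast c (suc v)) ≡ delay (c * suc v) (partitionCount≤ m) n
partSum≤-multAtLeast {m} {v} c n v<m = atLeast m n c n ≤-refl v<m
  where
  atLeast : ∀ m N c n → n ≤ N → suc v ≤ m →
    partSum≤ m n (multAtLeast c (suc v)) ≡ delay (c * suc v) (partitionCount≤ m) n
  atLeast m       N       zero    n       _         _ = refl
  atLeast (suc m) N       (suc c) zero    _         _ = refl
  atLeast (suc m) (suc N) (suc c) (suc n) (s≤s n≤N) (s≤s v≤m) with m≤n⇒m<n∨m≡n v≤m
  ... | inj₂ refl = begin
    partSum≤ (suc v) (suc n) A
      ≡⟨ partSum≤-suc v (suc n) A ⟩
    partSum≤ v (suc n) A + delay (suc v) (λ r → partSum≤ (suc v) r (A ∘ (suc v ∷_))) (suc n)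
      ≡⟨ cong₂ _+_ (partSum≤-multAtLeast-absent c (suc n) (n<1+n v))
                   (cong (if suc v ≤ᵇ suc n then_else 0)
                     (trans (sum-map-cong (multAtLeast-here c (suc v)) (partsAux (n ∸ v) (suc v) (n ∸ v)))
                            (atLeast (suc v) N c (n ∸ v) (≤-trans (m∸n≤m n v) n≤N) ≤-refl))) ⟩
    delay (suc v) (delay (c * suc v) (partitionCount≤ (suc v))) (suc n)
      ≡⟨ delay-+ (suc v) (c * suc v) (partitionCount≤ (suc v)) (suc n) ⟩
    delay (suc c * suc v) (partitionCount≤ (suc v)) (suc n) ∎
    where
    A : List ℕ → ℕ
    A = multAtLeast (suc c) (suc v)
  ... | inj₁ v<m = begin
    partSum≤ (suc m) (suc n) A
      ≡⟨ partSum≤-suc m (suc n) A ⟩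
    partSum≤ m (suc n) A + delay (suc m) (λ r → partSum≤ (suc m) r (A ∘ (suc m ∷_))) (suc n)
      ≡⟨ cong₂ _+_ (atLeast m (suc N) (suc c) (suc n) (s≤s n≤N) v<m)
                   (cong (if suc m ≤ᵇ suc n then_else 0)
                     (trans (sum-map-cong (λ ps → multAtLeast-there (suc c) ps (λ m≡v → <⇒≢ v<m (sym (suc-injective m≡v))))
                                          (partsAux (n ∸ m) (suc m) (n ∸ m)))
                            (atLeast (suc m) N (suc c) (n ∸ m) (≤-trans (m∸n≤m n m) n≤N) (s≤s v≤m)))) ⟩
    delay d P≤m (suc n) + delay (suc m) (delay d P≤m+1) (suc n)
      ≡⟨ cong (_+_ (delay d P≤m (suc n))) (delay-comm (suc m) d P≤m+1 (suc n)) ⟩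
    delay d P≤m (suc n) + delay d (delay (suc m) P≤m+1) (suc n)
      ≡⟨ delay-distrib-+ d P≤m (delay (suc m) P≤m+1) (suc n) ⟩
    delay d (λ x → P≤m x + delay (suc m) P≤m+1 x) (suc n)
      ≡⟨ delay-cong d {g = λ x → P≤m x + delay (suc m) P≤m+1 x} {h = P≤m+1} (suc n)
                    (sym (partSum≤-suc m (suc n ∸ d) (const 1))) ⟩
    delay d P≤m+1 (suc n) ∎
    where
    A : List ℕ → ℕ
    A = multAtLeast (suc c) (suc v)
    d : ℕ
    d = suc c * suc v
    P≤m P≤m+1 : ℕ → ℕ
    P≤m = partitionCount≤ m
    P≤m+1 = partitionCount≤ (suc m)

partitions-multAtLeast : ∀ c v n → suc v ≤ n →
  sum (map (multAtLeast c (suc v)) (partitions n)) ≡ delay (c * suc v) partitionCount n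
partitions-multAtLeast c v n v<n = begin
  partSum≤ n n (multAtLeast c (suc v))            ≡⟨ partSum≤-multAtLeast c n v<n ⟩
  delay (c * suc v) (partitionCount≤ n) n         ≡⟨ delay-cong (c * suc v) {g = partitionCount≤ n} {h = partitionCount} n
                                                     (partSum≤-large n (n ∸ c * suc v) (const 1) (m∸n≤m n (c * suc v))) ⟩
  delay (c * suc v) partitionCount n              ∎

aWeight : (K p : ℕ) .{{_ : NonZero K}} → ℕ → ℕ
aWeight K p d = if d % K ≡ᵇ p % K then d else 0

bWeight : (K : ℕ) .{{_ : NonZero K}} → ℕ → ℕ
bWeight K d = if d % K ≡ᵇ 0 then d / K else 0

aWeight-0 : ∀ K p .{{_ : NonZero K}} → aWeight K p 0 ≡ 0
aWeight-0 K p with 0 % K ≡ᵇ p % K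
... | true  = refl
... | false = refl

bWeight-< : ∀ K .{{_ : NonZero K}} {d} → d < K → bWeight K d ≡ 0
bWeight-< K {d} d<K with d % K ≡ᵇ 0
... | true  = m<n⇒m/n≡0 d<K
... | false = refl

bWeight-* : ∀ K .{{_ : NonZero K}} q → bWeight K (q * K) ≡ q
bWeight-* K q = trans (cong (λ r → if r ≡ᵇ 0 then q * K / K else 0) (m*n%n≡0 q K)) (m*n/n≡m q K)

bWeight-≢0 : ∀ K .{{_ : NonZero K}} {d} → d % K ≢ 0 → bWeight K d ≡ 0
bWeight-≢0 K {d} d%K≢0 = cong (if_then d / K else 0) (dec-false (d % K ≟ 0) d%K≢0)

bWeight-offset : ∀ K .{{_ : NonZero K}} {p} x → p < K → (x + p) % K ≢ p → bWeight K x ≡ 0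
bWeight-offset K {p} x p<K [x+p]%K≢p = bWeight-≢0 K (λ x%K≡0 → [x+p]%K≢p (begin
  (x + p) % K           ≡⟨ %-distribˡ-+ x p K ⟩
  (x % K + p % K) % K   ≡⟨ cong (λ r → (r + p % K) % K) x%K≡0 ⟩
  p % K % K             ≡⟨ m%n%n≡m%n p K ⟩
  p % K                 ≡⟨ m<n⇒m%n≡m p<K ⟩
  p                     ∎))

bWeight-∸ : ∀ K .{{_ : NonZero K}} {p d} → p < K → d % K ≢ p → bWeight K (d ∸ p) ≡ 0
bWeight-∸ K {p} {d} p<K d%K≢p with p ≤? d
... | yes p≤d = bWeight-offset K (d ∸ p) p<K (λ e → d%K≢p (trans (cong (_% K) (sym (m∸n+n≡m p≤d))) e))
... | no p≰d  = trans (cong (bWeight K) (m≤n⇒m∸n≡0 (<⇒≤ (≰⇒> p≰d)))) (bWeight-< K (≤-<-trans z≤n p<K))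

bWeight-+∸ : ∀ K .{{_ : NonZero K}} {p d} → p < K → d % K ≢ p → bWeight K (d + K ∸ p) ≡ 0
bWeight-+∸ K {p} {d} p<K d%K≢p = bWeight-offset K (d + K ∸ p) p<K (λ e → d%K≢p (begin
  d % K                 ≡⟨ sym ([m+n]%n≡m%n d K) ⟩
  (d + K) % K           ≡⟨ cong (_% K) (sym (m∸n+n≡m (≤-trans (<⇒≤ p<K) (m≤n+m K d)))) ⟩
  (d + K ∸ p + p) % K   ≡⟨ e ⟩
  p                     ∎))

aWeight-decomposition : ∀ K .{{_ : NonZero K}} {p} → p < K → ∀ d →
  aWeight K p d ≡ (K ∸ p) * bWeight K (d ∸ p) + p * bWeight K (d + K ∸ p)
aWeight-decomposition K {p} p<K d with d % K ≟ p
... | yes d%K≡p = begin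
  aWeight K p d
    ≡⟨ cong (if_then d else 0) (dec-true (d % K ≟ p % K) (trans d%K≡p (sym p%K≡p))) ⟩
  d
    ≡⟨ d≡p+qK ⟩
  p + q * K
    ≡⟨ cong (λ K′ → p + q * K′) (sym (m∸n+n≡m (<⇒≤ p<K))) ⟩
  p + q * (K ∸ p + p)
    ≡⟨ solve 3 (λ p q r → p :+ q :* (r :+ p) := r :* q :+ p :* (con 1 :+ q)) refl p q (K ∸ p) ⟩
  (K ∸ p) * q + p * suc q
    ≡⟨ sym (cong₂ (λ x y → (K ∸ p) * x + p * y) (bWeight-* K q) (bWeight-* K (suc q))) ⟩
  (K ∸ p) * bWeight K (q * K) + p * bWeight K (suc q * K)
    ≡⟨ sym (cong₂ (λ x y → (K ∸ p) * bWeight K x + p * bWeight K y) d∸p≡qK d+K∸p≡[q+1]K) ⟩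
  (K ∸ p) * bWeight K (d ∸ p) + p * bWeight K (d + K ∸ p) ∎
  where
  p%K≡p : p % K ≡ p
  p%K≡p = m<n⇒m%n≡m p<K
  q : ℕ
  q = d / K
  d≡p+qK : d ≡ p + q * K
  d≡p+qK = trans (m≡m%n+[m/n]*n d K) (cong (λ r → r + q * K) d%K≡p)
  d∸p≡qK : d ∸ p ≡ q * K
  d∸p≡qK = trans (cong (_∸ p) d≡p+qK) (m+n∸m≡n p (q * K))
  d+K∸p≡[q+1]K : d + K ∸ p ≡ suc q * K
  d+K∸p≡[q+1]K = trans (cong (λ e → e + K ∸ p) d≡p+qK)
                       (trans (cong (_∸ p) (+-assoc p (q * K) K)) (trans (m+n∸m≡n p _) (+-comm (q * K) K)))
... | no d%K≢p = begin
  aWeight K p d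
    ≡⟨ cong (if_then d else 0) (dec-false (d % K ≟ p % K) (λ e → d%K≢p (trans e (m<n⇒m%n≡m p<K)))) ⟩
  0
    ≡⟨ sym (cong₂ _+_ (*-zeroʳ (K ∸ p)) (*-zeroʳ p)) ⟩
  (K ∸ p) * 0 + p * 0
    ≡⟨ sym (cong₂ (λ x y → (K ∸ p) * x + p * y) (bWeight-∸ K p<K d%K≢p) (bWeight-+∸ K p<K d%K≢p)) ⟩
  (K ∸ p) * bWeight K (d ∸ p) + p * bWeight K (d + K ∸ p) ∎

-- The term u = n is omitted; this is harmless for the weights used here, which vanish at 0.
convolution : (ℕ → ℕ) → (ℕ → ℕ) → ℕ → ℕ
convolution w g n = ∑[ u < n ] (w (n ∸ u) * g u)

convolution-pad : ∀ (w g : ℕ → ℕ) {n N} → w 0 ≡ 0 → n ≤ N → ∑[ u < N ] (w (n ∸ u) * g u) ≡ convolution w g n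
convolution-pad w g {n} w0≡0 n≤N =
  ∑<-pad (λ u → w (n ∸ u) * g u) n≤N
         (λ u n≤u → trans (cong (λ d → w d * g u) (m≤n⇒m∸n≡0 n≤u)) (cong (_* g u) w0≡0))

∸-comm : ∀ m n o → m ∸ n ∸ o ≡ m ∸ o ∸ n
∸-comm m n o = trans (∸-+-assoc m n o) (trans (cong (m ∸_) (+-comm n o)) (sym (∸-+-assoc m o n)))

aWeight-decomposition-∸ : ∀ K .{{_ : NonZero K}} {p} → p < K → ∀ n u →
  aWeight K p (n ∸ u) ≡ (K ∸ p) * bWeight K (n ∸ p ∸ u) + p * bWeight K (n + K ∸ p ∸ u)
aWeight-decomposition-∸ K {p} p<K n u with u ≤? n
... | yes u≤n = begin
  aWeight K p (n ∸ u)
    ≡⟨ aWeight-decomposition K p<K (n ∸ u) ⟩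
  (K ∸ p) * bWeight K (n ∸ u ∸ p) + p * bWeight K (n ∸ u + K ∸ p)
    ≡⟨ cong₂ (λ x y → (K ∸ p) * bWeight K x + p * bWeight K y) (∸-comm n u p) (begin
         n ∸ u + K ∸ p   ≡⟨ cong (_∸ p) (sym (+-∸-comm K u≤n)) ⟩
         n + K ∸ u ∸ p   ≡⟨ ∸-comm (n + K) u p ⟩
         n + K ∸ p ∸ u   ∎) ⟩
  (K ∸ p) * bWeight K (n ∸ p ∸ u) + p * bWeight K (n + K ∸ p ∸ u) ∎
... | no u≰n = begin
  aWeight K p (n ∸ u)
    ≡⟨ trans (cong (aWeight K p) (m≤n⇒m∸n≡0 (<⇒≤ n<u))) (aWeight-0 K p) ⟩
  0
    ≡⟨ sym (cong₂ _+_ (*-zeroʳ (K ∸ p)) (*-zeroʳ p)) ⟩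
  (K ∸ p) * 0 + p * 0
    ≡⟨ sym (cong₂ (λ x y → (K ∸ p) * x + p * y) below above) ⟩
  (K ∸ p) * bWeight K (n ∸ p ∸ u) + p * bWeight K (n + K ∸ p ∸ u) ∎
  where
  n<u : n < u
  n<u = ≰⇒> u≰n
  below : bWeight K (n ∸ p ∸ u) ≡ 0
  below = trans (cong (bWeight K) (m≤n⇒m∸n≡0 (≤-trans (m∸n≤m n p) (<⇒≤ n<u)))) (bWeight-< K (≤-<-trans z≤n p<K))
  above : bWeight K (n + K ∸ p ∸ u) ≡ 0
  above = bWeight-< K (subst (_< K) (sym (∸-+-assoc (n + K) p u))
            (m<n+o⇒m∸n<o (n + K) (p + u) (+-monoˡ-< K (<-≤-trans n<u (m≤n+m u p)))))

aWeight-convolution : ∀ K .{{_ : NonZero K}} {p} → p < K → ∀ g n →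
  convolution (aWeight K p) g n ≡ (K ∸ p) * convolution (bWeight K) g (n ∸ p) + p * convolution (bWeight K) g (n + K ∸ p)
aWeight-convolution K {p} p<K g n = begin
  convolution (aWeight K p) g n
    ≡⟨ sym (convolution-pad (aWeight K p) g (aWeight-0 K p) (m≤m+n n K)) ⟩
  ∑[ u < n + K ] (aWeight K p (n ∸ u) * g u)
    ≡⟨ ∑<-cong (n + K) (λ u _ → trans (cong (_* g u) (aWeight-decomposition-∸ K p<K n u))
         (solve 5 (λ a x b y z → (a :* x :+ b :* y) :* z := a :* (x :* z) :+ b :* (y :* z)) refl
                (K ∸ p) (bWeight K (n ∸ p ∸ u)) p (bWeight K (n + K ∸ p ∸ u)) (g u))) ⟩
  ∑[ u < n + K ] ((K ∸ p) * lower u + p * upper u)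
    ≡⟨ ∑<-distrib-+ (n + K) (λ u → (K ∸ p) * lower u) (λ u → p * upper u) ⟩
  ∑[ u < n + K ] ((K ∸ p) * lower u) + ∑[ u < n + K ] (p * upper u)
    ≡⟨ sym (cong₂ _+_ (*-distribˡ-∑< (n + K) (K ∸ p) lower) (*-distribˡ-∑< (n + K) p upper)) ⟩
  (K ∸ p) * ∑< (n + K) lower + p * ∑< (n + K) upper
    ≡⟨ cong₂ (λ x y → (K ∸ p) * x + p * y)
         (convolution-pad (bWeight K) g bW0≡0 (≤-trans (m∸n≤m n p) (m≤m+n n K)))
         (convolution-pad (bWeight K) g bW0≡0 (m∸n≤m (n + K) p)) ⟩
  (K ∸ p) * convolution (bWeight K) g (n ∸ p) + p * convolution (bWeight K) g (n + K ∸ p) ∎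
  where
  lower upper : ℕ → ℕ
  lower u = bWeight K (n ∸ p ∸ u) * g u
  upper u = bWeight K (n + K ∸ p ∸ u) * g u
  bW0≡0 : bWeight K 0 ≡ 0
  bW0≡0 = bWeight-< K (≤-<-trans z≤n p<K)

delay-convolution : ∀ (w g : ℕ → ℕ) n → ∑[ j < n ] (w (suc j) * delay (suc j) g n) ≡ convolution w g n
delay-convolution w g n = begin
  ∑[ j < n ] (w (suc j) * delay (suc j) g n)
    ≡⟨ ∑<-cong n (λ j j<n → cong (w (suc j) *_) (if-≤ᵇ-yes j<n)) ⟩
  ∑[ j < n ] (w (suc j) * g (n ∸ suc j))
    ≡⟨ ∑<-reverse n (λ j → w (suc j) * g (n ∸ suc j)) ⟩
  ∑[ j < n ] (w (suc (n ∸ suc j)) * g (n ∸ suc (n ∸ suc j)))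
    ≡⟨ ∑<-cong n (λ j j<n → cong₂ (λ x y → w x * g y) (sym (+-∸-assoc 1 j<n))
                             (trans (cong (n ∸_) (sym (+-∸-assoc 1 j<n))) (m∸[m∸n]≡n (<⇒≤ j<n)))) ⟩
  convolution w g n ∎

∑<-blocks : ∀ K q (g : ℕ → ℕ) → ∑< (q * K) g ≡ ∑[ j < q ] ∑[ s < K ] g (j * K + s)
∑<-blocks K zero    g = refl
∑<-blocks K (suc q) g = begin
  ∑< (K + q * K) g
    ≡⟨ ∑<-split K (q * K) g ⟩
  ∑< K g + ∑[ i < q * K ] g (K + i)
    ≡⟨ cong (_+_ (∑< K g)) (∑<-blocks K q (λ i → g (K + i))) ⟩
  ∑< K g + ∑[ j < q ] ∑[ s < K ] g (K + (j * K + s))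
    ≡⟨ cong (_+_ (∑< K g)) (∑<-cong q (λ j _ → ∑<-cong K (λ s _ → cong g (sym (+-assoc K (j * K) s))))) ⟩
  ∑[ j < suc q ] ∑[ s < K ] g (j * K + s) ∎

bWeight-block : ∀ K .{{_ : NonZero K}} (h : ℕ → ℕ) j →
  ∑[ s < K ] (bWeight K (suc (j * K + s)) * h (suc (j * K + s))) ≡ suc j * h (suc j * K)
bWeight-block K@(suc k) h j = begin
  ∑[ s < K ] term s
    ≡⟨ ∑<-suc k term ⟩
  ∑[ s < k ] term s + term k
    ≡⟨ cong₂ _+_ (∑<-zero k (λ s s<k → cong (_* h (suc (j * K + s))) (bWeight-≢0 K {suc (j * K + s)} (suc[jK+s]%K≢0 s s<k))))
                 (cong (λ d → bWeight K d * h d) (cong suc (+-comm (j * K) k))) ⟩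
  bWeight K (suc j * K) * h (suc j * K)
    ≡⟨ cong (_* h (suc j * K)) (bWeight-* K (suc j)) ⟩
  suc j * h (suc j * K) ∎
  where
  term : ℕ → ℕ
  term s = bWeight K (suc (j * K + s)) * h (suc (j * K + s))
  suc[jK+s]%K≢0 : ∀ s → s < k → suc (j * K + s) % K ≢ 0
  suc[jK+s]%K≢0 s s<k e = 1+n≢0 (begin
    suc s                  ≡⟨ sym (m<n⇒m%n≡m (s≤s s<k)) ⟩
    suc s % K              ≡⟨ sym ([m+kn]%n≡m%n (suc s) j K) ⟩
    (suc s + j * K) % K    ≡⟨ cong (λ x → suc x % K) (+-comm s (j * K)) ⟩
    suc (j * K + s) % K    ≡⟨ e ⟩
    0                      ∎)

-- Only multiples d = (j + 1) K carry weight; grouping the indices into blocks of length K picks them out.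
multiples-convolution : ∀ K .{{_ : NonZero K}} (g : ℕ → ℕ) n →
  ∑[ j < n ] (suc j * delay (K * suc j) g n) ≡ convolution (bWeight K) g n
multiples-convolution K g n = begin
  ∑[ j < n ] (suc j * delay (K * suc j) g n)
    ≡⟨ ∑<-cong n (λ j _ → cong (λ d → suc j * delay d g n) (*-comm K (suc j))) ⟩
  ∑[ j < n ] (suc j * delay (suc j * K) g n)
    ≡⟨ sym (∑<-cong n (λ j _ → bWeight-block K (λ d → delay d g n) j)) ⟩
  ∑[ j < n ] ∑[ s < K ] h (j * K + s)
    ≡⟨ sym (∑<-blocks K n h) ⟩
  ∑< (n * K) h
    ≡⟨ ∑<-pad h (m≤m*n n K) (λ i n≤i → trans (cong (bWeight K (suc i) *_) (if-≤ᵇ-no (λ i<n → <⇒≱ i<n n≤i)))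
                                             (*-zeroʳ (bWeight K (suc i)))) ⟩
  ∑< n h
    ≡⟨ delay-convolution (bWeight K) g n ⟩
  convolution (bWeight K) g n ∎
  where
  h : ℕ → ℕ
  h i = bWeight K (suc i) * delay (suc i) g n

sum-distinctSum : ∀ n (P : List ℕ → ℕ → Bool) (w : ℕ → ℕ) c →
  (∀ ps v → (if (1 ≤ᵇ mult v ps) ∧ P ps v then v else 0) ≡ w v * multAtLeast c v ps) →
  sum (map (λ ps → distinctSum (P ps) n ps) (partitions n)) ≡ ∑[ j < n ] (w (suc j) * delay (c * suc j) partitionCount n)
sum-distinctSum n P w c term = begin
  sum (map (λ ps → distinctSum (P ps) n ps) (partitions n))
    ≡⟨ sum-map-cong (λ ps → cong sum (map-upTo (summand ps) n)) (partitions n) ⟩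
  sum (map (λ ps → ∑< n (summand ps)) (partitions n))
    ≡⟨ sum-map-∑<-comm n summand (partitions n) ⟩
  ∑[ j < n ] sum (map (λ ps → summand ps j) (partitions n))
    ≡⟨ ∑<-cong n (λ j j<n → begin
         sum (map (λ ps → summand ps j) (partitions n))
           ≡⟨ sum-map-cong (λ ps → term ps (suc j)) (partitions n) ⟩
         sum (map (λ ps → w (suc j) * multAtLeast c (suc j) ps) (partitions n))
           ≡⟨ sym (*-distribˡ-sum-map (w (suc j)) (multAtLeast c (suc j)) (partitions n)) ⟩
         w (suc j) * sum (map (multAtLeast c (suc j)) (partitions n))
           ≡⟨ cong (w (suc j) *_) (partitions-multAtLeast c j n j<n) ⟩
         w (suc j) * delay (c * suc j) partitionCount n ∎) ⟩
  ∑[ j < n ] (w (suc j) * delay (c * suc j) partitionCount n) ∎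
  where
  summand : List ℕ → ℕ → ℕ
  summand ps j = if (1 ≤ᵇ mult (suc j) ps) ∧ P ps (suc j) then suc j else 0

aMod-convolution : ∀ k p n → aMod (suc k) p n ≡ convolution (aWeight (suc k) p) partitionCount n
aMod-convolution k p n = begin
  aMod (suc k) p n
    ≡⟨ sum-distinctSum n (λ _ v → v % suc k ≡ᵇ p % suc k) (aWeight (suc k) p) 1
         (λ ps v → if-∧-indicator (1 ≤ᵇ mult v ps) (v % suc k ≡ᵇ p % suc k) v) ⟩
  ∑[ j < n ] (aWeight (suc k) p (suc j) * delay (1 * suc j) partitionCount n)
    ≡⟨ ∑<-cong n (λ j _ → cong (λ d → aWeight (suc k) p (suc j) * delay d partitionCount n) (*-identityˡ (suc j))) ⟩
  ∑[ j < n ] (aWeight (suc k) p (suc j) * delay (suc j) partitionCount n)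
    ≡⟨ delay-convolution (aWeight (suc k) p) partitionCount n ⟩
  convolution (aWeight (suc k) p) partitionCount n ∎

b-convolution : ∀ k n → b (suc k) n ≡ convolution (bWeight (suc k)) partitionCount n
b-convolution k n = begin
  b (suc k) n
    ≡⟨ sum-distinctSum n (λ ps v → suc k ≤ᵇ mult v ps) (λ v → v) (suc k) (λ ps v → term (mult v ps) v) ⟩
  ∑[ j < n ] (suc j * delay (suc k * suc j) partitionCount n)
    ≡⟨ multiples-convolution (suc k) partitionCount n ⟩
  convolution (bWeight (suc k)) partitionCount n ∎
  where
  term : ∀ x v → (if (1 ≤ᵇ x) ∧ (suc k ≤ᵇ x) then v else 0) ≡ v * (if suc k ≤ᵇ x then 1 else 0)
  term zero    v = sym (*-zeroʳ v)
  term (suc x) v = if-indicator (suc k ≤ᵇ suc x) v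

bℤ-+- : ∀ k n p → bℤ k (+ n - + p) ≡ b k (n ∸ p)
bℤ-+- k n p with p ≤? n
... | yes p≤n = cong (bℤ k) (trans (m-n≡m⊖n n p) (⊖-≥ p≤n))
... | no p≰n  = trans (cong (bℤ k) (trans (m-n≡m⊖n n p) (⊖-< (≰⇒> p≰n))))
                      (trans (negative (p ∸ n) (m<n⇒0<n∸m (≰⇒> p≰n)))
                             (sym (cong (b k) (m≤n⇒m∸n≡0 (<⇒≤ (≰⇒> p≰n))))))
  where
  negative : ∀ t → 0 < t → bℤ k (- + t) ≡ b k 0
  negative (suc t) _ = refl

aMod-identity : ∀ k p → p < suc k → ∀ n →
  aMod (suc k) p n ≡ (suc k ∸ p) * b (suc k) (n ∸ p) + p * b (suc k) (n + suc k ∸ p)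
aMod-identity k p p<K n = begin
  aMod (suc k) p n
    ≡⟨ aMod-convolution k p n ⟩
  convolution (aWeight (suc k) p) partitionCount n
    ≡⟨ aWeight-convolution (suc k) p<K partitionCount n ⟩
  (suc k ∸ p) * convolution (bWeight (suc k)) partitionCount (n ∸ p)
    + p * convolution (bWeight (suc k)) partitionCount (n + suc k ∸ p)
    ≡⟨ sym (cong₂ (λ x y → (suc k ∸ p) * x + p * y) (b-convolution k (n ∸ p)) (b-convolution k (n + suc k ∸ p))) ⟩
  (suc k ∸ p) * b (suc k) (n ∸ p) + p * b (suc k) (n + suc k ∸ p) ∎

theorem2p2 : (k p : ℕ) → 1 ≤ k → p < k → (n : ℕ) → 1 ≤ n →
    (a k n ≡ k * b k n)
    × (aMod k p n ≡ (k ∸ p) * bℤ k (+ n - + p) + p * b k (n + k ∸ p))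
theorem2p2 (suc k) p _ p<k n _ = a≡kb , aMod≡
  where
  aMod≡ : aMod (suc k) p n ≡ (suc k ∸ p) * bℤ (suc k) (+ n - + p) + p * b (suc k) (n + suc k ∸ p)
  aMod≡ = trans (aMod-identity k p p<k n)
                (cong (λ x → (suc k ∸ p) * x + p * b (suc k) (n + suc k ∸ p)) (sym (bℤ-+- (suc k) n p)))
  -- a (suc k) n is definitionally aMod (suc k) 0 n
  a≡kb : a (suc k) n ≡ suc k * b (suc k) n
  a≡kb = trans (aMod-identity k 0 z<s n) (+-identityʳ _)
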